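{- Let $\mathcal{A}$ be a non-empty algebra in $\mathcal{C}$. Then $\mathcal{A}$ has CBLP iff, for all $\theta\in{\rm Con}(\mathcal{A})$, $\mathcal{A}/\theta$ has CBLP.
   Context: $\mathcal{C}$ is an equational class of congruence-distributive algebras of some signature, such that every non-empty algebra $\mathcal{A}$ in $\mathcal{C}$ satisfies (H): $\nabla_{\mathcal{A}}=A^2$ is compact in the congruence lattice ${\rm Con}(\mathcal{A})$. $\mathcal{B}(L)$ denotes the Boolean center of a bounded distributive lattice $L$. For $\theta\in{\rm Con}(\mathcal{A})$, $u_\theta:{\rm Con}(\mathcal{A})\to{\rm Con}(\mathcal{A}/\theta)$, $u_\theta(\alpha)=(\alpha\vee\theta)/\theta$ (with $\phi/\theta=\{(a/\theta,b/\theta)\mid(a,b)\in\phi\}$); $\theta$ has CBLP iff the restriction of $u_\theta$ from $\mathcal{B}({\rm Con}(\mathcal{A}))$ to $\mathcal{B}({\rm Con}(\mathcal{A}/\theta))$ is surjective; an algebra has CBLP iff all of its congruences have CBLP. -}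

module Defs where

open import Data.Nat using (ℕ)
open import Data.Fin using (Fin)
open import Data.Bool using (Bool; true; false)
open import Data.Product using (Σ; ∃; _×_; _,_)
open import Data.Unit using (⊤)
open import Function.Bundles using (_⇔_)
open import Relation.Binary.Structures using (IsEquivalence)

-- Signatures (finitary) and algebras (setoid-based, since quotients
-- are not available as types: A/θ has the same carrier with equality θ)

record Signature : Set₁ where
  field
    Op    : Set
    arity : Op → ℕ
open Signature public

record Algebra (σ : Signature) : Set₁ where
  field
    Carrier : Set
    _≈_     : Carrier → Carrier → Set
    isEquiv : IsEquivalence _≈_
    op      : (f : Op σ) → (Fin (arity σ f) → Carrier) → Carrier
    op-cong : ∀ f {xs ys} → (∀ i → xs i ≈ ys i) → op f xs ≈ op f ys
open Algebra public

Rel : ∀ {σ} → Algebra σ → Set₁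
Rel A = Carrier A → Carrier A → Set

record Con {σ : Signature} (A : Algebra σ) : Set₁ where
  field
    rel     : Rel A
    isEquiv : IsEquivalence rel
    ≈⊆      : ∀ {x y} → _≈_ A x y → rel x y
    compat  : ∀ f {xs ys} → (∀ i → rel (xs i) (ys i)) → rel (op A f xs) (op A f ys)
open Con public

module _ {σ : Signature} (A : Algebra σ) where

  _⊆_ : Rel A → Rel A → Set
  R ⊆ S = ∀ {x y} → R x y → S x y

  _≐_ : Rel A → Rel A → Set
  R ≐ S = (R ⊆ S) × (S ⊆ R)

  Δ : Rel A
  Δ = _≈_ A

  ∇ : Rel A
  ∇ _ _ = ⊤

  _∧_ : Rel A → Rel A → Rel A
  (R ∧ S) x y = R x y × S x y

  data ⋁ {I : Set} (α : I → Con A) : Rel A where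
    base  : ∀ {x y} → _≈_ A x y → ⋁ α x y
    step  : ∀ i {x y} → rel (α i) x y → ⋁ α x y
    trans : ∀ {x y z} → ⋁ α x y → ⋁ α y z → ⋁ α x z

  _∨_ : Con A → Con A → Rel A
  α ∨ β = ⋁ {Bool} (λ { true → α ; false → β })

  CongDistributive : Set₁
  CongDistributive = ∀ (α β γ : Con A) →
    (rel α ∧ (β ∨ γ)) ≐ ⋁ {Bool} (λ { true → meetCon α β ; false → meetCon α γ })
    where
    meetCon : Con A → Con A → Con A
    meetCon α β = record
      { rel = rel α ∧ rel β
      ; isEquiv = record
          { refl  = IsEquivalence.refl (isEquiv α) , IsEquivalence.refl (isEquiv β)
          ; sym   = λ { (p , q) → IsEquivalence.sym (isEquiv α) p , IsEquivalence.sym (isEquiv β) q }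
          ; trans = λ { (p , q) (p' , q') → IsEquivalence.trans (isEquiv α) p p'
                                          , IsEquivalence.trans (isEquiv β) q q' } }
      ; ≈⊆ = λ e → ≈⊆ α e , ≈⊆ β e
      ; compat = λ f h → compat α f (λ i → Data.Product.proj₁ (h i))
                       , compat β f (λ i → Data.Product.proj₂ (h i)) }

  NablaCompact : Set₁
  NablaCompact = ∀ {I : Set} (α : I → Con A) → ∇ ⊆ ⋁ α →
    Σ ℕ λ n → Σ (Fin n → I) λ f → ∇ ⊆ ⋁ (λ k → α (f k))

  IsBoolean : Con A → Set₁
  IsBoolean α = Σ (Con A) λ β → ((rel α ∧ rel β) ≐ Δ) × ((α ∨ β) ≐ ∇)

  Nonempty : Set
  Nonempty = Carrier A

_/_ : ∀ {σ} (A : Algebra σ) → Con A → Algebra σ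
A / θ = record
  { Carrier = Carrier A
  ; _≈_     = rel θ
  ; isEquiv = isEquiv θ
  ; op      = op A
  ; op-cong = compat θ }

-- φ/θ = {(a/θ, b/θ) | (a,b) ∈ φ}, as a relation on the carrier of A/θ
quotRel : ∀ {σ} (A : Algebra σ) (θ : Con A) → Rel A → Rel (A / θ)
quotRel A θ φ x y = Σ (Carrier A) λ a → Σ (Carrier A) λ b →
  rel θ x a × φ a b × rel θ b y

u : ∀ {σ} (A : Algebra σ) (θ : Con A) → Con A → Rel (A / θ)
u A θ α = quotRel A θ (_∨_ A α θ)

CBLP : ∀ {σ} (A : Algebra σ) → Con A → Set₁
CBLP A θ = ∀ (β : Con (A / θ)) → IsBoolean (A / θ) β →
  Σ (Con A) λ α → IsBoolean A α × _≐_ (A / θ) (u A θ α) (rel β)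

HasCBLP : ∀ {σ} → Algebra σ → Set₁
HasCBLP A = ∀ (θ : Con A) → CBLP A θ

data Term (σ : Signature) (X : Set) : Set where
  var : X → Term σ X
  app : (f : Op σ) → (Fin (arity σ f) → Term σ X) → Term σ X

eval : ∀ {σ} (A : Algebra σ) → (ℕ → Carrier A) → Term σ ℕ → Carrier A
eval A ρ (var x)    = ρ x
eval A ρ (app f ts) = op A f (λ i → eval A ρ (ts i))

_⊨_≋_ : ∀ {σ} → Algebra σ → Term σ ℕ → Term σ ℕ → Set
A ⊨ s ≋ t = ∀ (ρ : ℕ → Carrier A) → _≈_ A (eval A ρ s) (eval A ρ t)

InClass : ∀ {σ} → (Term σ ℕ → Term σ ℕ → Set) → Algebra σ → Set
InClass E A = ∀ s t → E s t → A ⊨ s ≋ t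

module Submission where

-- Congruences of A/θ are exactly the congruences of A above θ
-- (on the shared carrier they are literally the same relations), and
-- (A/θ)/φ is literally A/φ.  Given a Boolean β of (A/θ)/φ, CBLP of φ in A
-- yields a Boolean α of Con(A) with u_φ(α) = β; its image α ∨ θ in Con(A/θ)
-- is again Boolean (complement γ ∨ θ; the meet is computed with congruence
-- distributivity) and has the same u-image, since θ ⊆ φ.  So CBLP passes
-- from A to every quotient A/θ; conversely A ≅ A/Δ_A.

open import Defs
open import Data.Nat using (ℕ; zero; suc)
open import Data.Fin using (Fin; zero; suc)
open import Data.Bool using (true; false)
open import Data.Product using (_,_; proj₁; proj₂)
open import Data.Unit using (tt)
open import Data.Vec.Functional using (_∷_; head; tail)
open import Function.Bundles using (_⇔_; mk⇔)
open import Relation.Binary.Structures using (IsEquivalence)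

module Congruences {σ : Signature} (A : Algebra σ) where

  ≈-refl : ∀ {x} → _≈_ A x x
  ≈-refl = IsEquivalence.refl (Algebra.isEquiv A)

  ≈-sym : ∀ {x y} → _≈_ A x y → _≈_ A y x
  ≈-sym = IsEquivalence.sym (Algebra.isEquiv A)

  con-refl : (α : Con A) → ∀ {x} → rel α x x
  con-refl α = IsEquivalence.refl (Con.isEquiv α)

  con-sym : (α : Con A) → ∀ {x y} → rel α x y → rel α y x
  con-sym α = IsEquivalence.sym (Con.isEquiv α)

  con-trans : (α : Con A) → ∀ {x y z} → rel α x y → rel α y z → rel α x z
  con-trans α = IsEquivalence.trans (Con.isEquiv α)

  -- The least congruence Δ_A; the quotient A/Δ_A is definitionally A.
  Δ-con : Con A
  Δ-con = record { rel = _≈_ A ; isEquiv = Algebra.isEquiv A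
                 ; ≈⊆ = λ e → e ; compat = op-cong A }

  ≐-trans : ∀ {R S T : Rel A} → _≐_ A R S → _≐_ A S T → _≐_ A R T
  ≐-trans (R⊆S , S⊆R) (S⊆T , T⊆S) = (λ r → S⊆T (R⊆S r)) , (λ t → S⊆R (T⊆S t))

  ⋁-elim : ∀ {I} {α : I → Con A} {R : Rel A}
    → _⊆_ A (_≈_ A) R
    → (∀ i → _⊆_ A (rel (α i)) R)
    → (∀ {x y z} → R x y → R y z → R x z)
    → _⊆_ A (⋁ A α) R
  ⋁-elim Δ⊆R α⊆R R-trans (base e)    = Δ⊆R e
  ⋁-elim Δ⊆R α⊆R R-trans (step i p)  = α⊆R i p
  ⋁-elim Δ⊆R α⊆R R-trans (trans p q) =
    R-trans (⋁-elim Δ⊆R α⊆R R-trans p) (⋁-elim Δ⊆R α⊆R R-trans q)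

  ⋁-sym : ∀ {I} {α : I → Con A} {x y} → ⋁ A α x y → ⋁ A α y x
  ⋁-sym (base e)            = base (≈-sym e)
  ⋁-sym {α = α} (step i p)  = step i (con-sym (α i) p)
  ⋁-sym (trans p q)         = trans (⋁-sym q) (⋁-sym p)

  Preserves : ∀ {n} → Rel A → ((Fin n → Carrier A) → Carrier A) → Set
  Preserves R g = ∀ {xs ys} → (∀ i → R (xs i) (ys i)) → R (g xs) (g ys)

  ∷-related : ∀ {n} (R : Rel A) {a b} {xs ys : Fin n → Carrier A}
    → R a b → (∀ i → R (xs i) (ys i)) → ∀ i → R ((a ∷ xs) i) ((b ∷ ys) i)
  ∷-related R r rs zero    = r
  ∷-related R r rs (suc i) = rs i

  η-related : ∀ {n} (R : Rel A) → (∀ {x} → R x x)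
    → (xs : Fin (suc n) → Carrier A) → ∀ i → R (xs i) ((head xs ∷ tail xs) i)
  η-related R r xs zero    = r
  η-related R r xs (suc i) = r

  ⋁-unary : ∀ {I} {α : I → Con A} (p : Carrier A → Carrier A)
    → (∀ {x y} → _≈_ A x y → _≈_ A (p x) (p y))
    → (∀ i {x y} → rel (α i) x y → rel (α i) (p x) (p y))
    → ∀ {x y} → ⋁ A α x y → ⋁ A α (p x) (p y)
  ⋁-unary p p≈ pα (base e)    = base (p≈ e)
  ⋁-unary p p≈ pα (step i r)  = step i (pα i r)
  ⋁-unary p p≈ pα (trans r s) = trans (⋁-unary p p≈ pα r) (⋁-unary p p≈ pα s)

  -- The n-ary case: change the head with ⋁-unary, the tail by induction.
  ⋁-preserves : ∀ {I} {α : I → Con A} n (g : (Fin n → Carrier A) → Carrier A)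
    → Preserves (_≈_ A) g → (∀ i → Preserves (rel (α i)) g)
    → Preserves (⋁ A α) g
  ⋁-preserves zero g g≈ gα h = base (g≈ λ ())
  ⋁-preserves {α = α} (suc n) g g≈ gα {xs} {ys} h =
    trans (base (g≈ (η-related (_≈_ A) ≈-refl xs)))
    (trans (⋁-unary (λ a → g (a ∷ tail xs))
                    (λ e → g≈ (∷-related (_≈_ A) e (λ _ → ≈-refl)))
                    (λ i r → gα i (∷-related (rel (α i)) r (λ _ → con-refl (α i))))
                    (h zero))
    (trans (⋁-preserves n (λ ws → g (head ys ∷ ws))
                          (λ e → g≈ (∷-related (_≈_ A) ≈-refl e))
                          (λ i e → gα i (∷-related (rel (α i)) (con-refl (α i)) e))
                          (λ i → h (suc i)))
    (base (≈-sym (g≈ (η-related (_≈_ A) ≈-refl ys))))))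

  ⋁-compat : ∀ {I} (α : I → Con A) f → Preserves (⋁ A α) (op A f)
  ⋁-compat α f = ⋁-preserves (arity σ f) (op A f) (op-cong A f) (λ i → compat (α i) f)

  _⊔_ : Con A → Con A → Con A
  α ⊔ β = record
    { rel     = _∨_ A α β
    ; isEquiv = record { refl = base ≈-refl ; sym = ⋁-sym ; trans = trans }
    ; ≈⊆      = base
    ; compat  = ⋁-compat _ }

  meet-join-below : CongDistributive A → ∀ (α β γ θ : Con A)
    → _⊆_ A (_∧_ A (rel α) (rel β)) (rel θ)
    → _⊆_ A (_∧_ A (rel α) (rel γ)) (rel θ)
    → _⊆_ A (_∧_ A (rel α) (_∨_ A β γ)) (rel θ)
  meet-join-below cd α β γ θ αβ⊆θ αγ⊆θ p =
    ⋁-elim (≈⊆ θ) (λ { true → αβ⊆θ ; false → αγ⊆θ }) (con-trans θ)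
           (proj₁ (cd α β γ) p)

open Congruences

module Quotient {σ : Signature} (A : Algebra σ) (θ : Con A) where

  -- A congruence of A/θ, read as a congruence of A (it lies above θ);
  -- then A / embed φ is definitionally (A/θ)/φ.
  embed : Con (A / θ) → Con A
  embed φ = record { rel = rel φ ; isEquiv = Con.isEquiv φ
                   ; ≈⊆ = λ e → ≈⊆ φ (≈⊆ θ e) ; compat = compat φ }

  extend : Con A → Con (A / θ)
  extend α = record { rel = rel (_⊔_ A α θ) ; isEquiv = Con.isEquiv (_⊔_ A α θ)
                    ; ≈⊆ = step false ; compat = compat (_⊔_ A α θ) }

  -- If α has complement γ in Con(A), then α ∨ θ has complement γ ∨ θ in
  -- Con(A/θ): (α ∨ θ) ∧ (γ ∨ θ) = θ uses distributivity twice, and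
  -- ∇ = α ∨ γ ⊆ (α ∨ θ) ∨ (γ ∨ θ).
  extend-boolean : CongDistributive A → ∀ {α} → IsBoolean A α → IsBoolean (A / θ) (extend α)
  extend-boolean cd {α} (γ , (αγ⊆Δ , _) , (_ , ∇⊆α∨γ)) =
    extend γ , (meet⊆θ , (λ t → step false t , step false t))
             , ((λ _ → tt) , λ _ → ∨-extend (∇⊆α∨γ tt))
    where
    γ∧[α∨θ]⊆θ : _⊆_ A (_∧_ A (rel γ) (_∨_ A α θ)) (rel θ)
    γ∧[α∨θ]⊆θ = meet-join-below A cd γ α θ θ
                  (λ { (g , a) → ≈⊆ θ (αγ⊆Δ (a , g)) }) proj₂

    meet⊆θ : _⊆_ A (_∧_ A (_∨_ A α θ) (_∨_ A γ θ)) (rel θ)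
    meet⊆θ = meet-join-below A cd (_⊔_ A α θ) γ θ θ
               (λ { (a , g) → γ∧[α∨θ]⊆θ (g , a) }) proj₂

    ∨-extend : _⊆_ A (_∨_ A α γ) (_∨_ (A / θ) (extend α) (extend γ))
    ∨-extend = ⋁-elim A (λ e → base (≈⊆ θ e))
                 (λ { true a → step true (step true a) ; false g → step false (step true g) })
                 trans

  -- For θ ⊆ φ: (α ∨ θ) ∨ φ = α ∨ φ, computed in A/θ and in A respectively.
  extend-join : ∀ α φ → _≐_ A (_∨_ (A / θ) (extend α) φ) (_∨_ A α (embed φ))
  extend-join α φ = to , from
    where
    to : _⊆_ A (_∨_ (A / θ) (extend α) φ) (_∨_ A α (embed φ))
    to = ⋁-elim (A / θ) (λ t → step false (≈⊆ φ t))
           (λ { true  p → ⋁-elim A base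
                            (λ { true a → step true a ; false t → step false (≈⊆ φ t) })
                            trans p
              ; false f → step false f })
           trans

    from : _⊆_ A (_∨_ A α (embed φ)) (_∨_ (A / θ) (extend α) φ)
    from = ⋁-elim A (λ e → base (≈⊆ θ e))
             (λ { true a → step true (step true a) ; false f → step false f })
             trans

  u-extend : ∀ α φ → _≐_ A (u (A / θ) φ (extend α)) (u A (embed φ) α)
  u-extend α φ =
      (λ { (a , b , xa , ab , by) → a , b , xa , proj₁ (extend-join α φ) ab , by })
    , (λ { (a , b , xa , ab , by) → a , b , xa , proj₂ (extend-join α φ) ab , by })

  CBLP-descends : CongDistributive A → ∀ φ → CBLP A (embed φ) → CBLP (A / θ) φ
  CBLP-descends cd φ cblp β β-boolean
    with cblp β β-boolean
  ... | α , α-boolean , uα≐β =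
    extend α , extend-boolean cd α-boolean , ≐-trans A (u-extend α φ) uα≐β

corollary4p28 : (σ : Signature) (E : Term σ ℕ → Term σ ℕ → Set)
    → (∀ (B : Algebra σ) → InClass E B → CongDistributive B)
    → (∀ (B : Algebra σ) → InClass E B → Nonempty B → NablaCompact B)
    → (A : Algebra σ) → InClass E A → Nonempty A
    → HasCBLP A ⇔ (∀ (θ : Con A) → HasCBLP (A / θ))
corollary4p28 σ E distributive _ A A∈E _ = mk⇔ descend ascend
  where
  -- every congruence of A/θ comes from a congruence of A above θ
  descend : HasCBLP A → ∀ θ → HasCBLP (A / θ)
  descend hasCBLP θ φ =
    Quotient.CBLP-descends A θ (distributive A A∈E) φ (hasCBLP (Quotient.embed A θ φ))

  -- A is A/Δ_A
  ascend : (∀ θ → HasCBLP (A / θ)) → HasCBLP A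
  ascend quotientsHaveCBLP = quotientsHaveCBLP (Δ-con A)
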